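{- There is a class $\mathcal{H}$ of graphs with $\sup_{H\in\mathcal{H}}\mathrm{tw}(H)=1$ and a graph class $\mathcal{G}$ containing $K_2$ such that $\mathcal{H}$ is not $(c^{\mathcal{G}}_{\mathrm u},c^{\mathcal{G}}_{\mathrm l})$-bounded.
   Context: All graphs are finite and simple; $\mathrm{tw}$ denotes treewidth. For graphs $G,H$, a homomorphism $\varphi\colon G\to H$ is a map $V(G)\to V(H)$ with $\varphi(u)\varphi(v)\in E(H)$ whenever $uv\in E(G)$. $\dot\cup$ denotes vertex-disjoint union. For a graph class $\mathcal{G}$ and a graph $H$, a $\mathcal{G}$-cover of $H$ is an edge-surjective homomorphism $\varphi\colon G_1\dot\cup\cdots\dot\cup G_t\to H$ with all $G_i\in\mathcal{G}$; it is called $t$-global, injective if each $\varphi|_{G_i}$ is injective, and $s$-local if $|\varphi^{ -1}(v)|\le s$ for all $v\in V(H)$. $\overline{\mathcal{G}}$ is the class of all vertex-disjoint unions of graphs in $\mathcal{G}$. $c^{\mathcal{G}}_{\mathrm u}(H)$ is the least $t$ such that $H$ has a $t$-global injective $\overline{\mathcal{G}}$-cover; $c^{\mathcal{G}}_{\mathrm l}(H)$ is the least $s$ such that $H$ has an $s$-local injective $\mathcal{G}$-cover. $\mathcal{H}$ is $(c^{\mathcal{G}}_{\mathrm u},c^{\mathcal{G}}_{\mathrm l})$-bounded if there is $f\colon\mathbb{N}\to\mathbb{R}_{\ge0}$ with $c^{\mathcal{G}}_{\mathrm l}(H)\le c^{\mathcal{G}}_{\mathrm u}(H)\le f(c^{\mathcal{G}}_{\mathrm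 l}(H))$ for all $H\in\mathcal{H}$. -}

module Defs where

open import Data.Nat using (ℕ; zero; suc; _≤_)
open import Data.Fin using (Fin; zero; suc; inject₁; fromℕ; _≟_)
open import Data.Fin.Subset using (Subset; _∈_; ∣_∣)
open import Data.List using (List; length; filter; map; allFin)
open import Data.Nat.ListAction using (sum)
open import Data.Product using (Σ; Σ-syntax; ∃; ∃-syntax; _×_; _,_)
open import Data.Unit using (⊤)
open import Relation.Nullary using (¬_)
open import Relation.Binary.PropositionalEquality as Eq using (_≡_; _≢_; refl)
open import Function.Definitions using (Injective)

record Graph : Set₁ where
  field
    n      : ℕ
    E      : Fin n → Fin n → Set
    sym    : ∀ {u v} → E u v → E v u
    irrefl : ∀ {u} → ¬ E u u
open Graph public

GraphClass : Set₁
GraphClass = Graph → Set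

K2 : Graph
K2 = record
  { n = 2
  ; E = λ u v → u ≢ v
  ; sym = λ p q → p (Eq.sym q)
  ; irrefl = λ p → p refl
  }

IsHom : (G H : Graph) → (Fin (n G) → Fin (n H)) → Set
IsHom G H f = ∀ u v → E G u v → E H (f u) (f v)

data Walk (G : Graph) (P : Fin (n G) → Set) : Fin (n G) → Fin (n G) → Set where
  here : ∀ {u} → P u → Walk G P u u
  step : ∀ {u w v} → P u → E G u w → Walk G P w v → Walk G P u v

Connected : Graph → Set
Connected G = ∀ u v → Walk G (λ _ → ⊤) u v

HasCycle : Graph → Set
HasCycle G =
  Σ[ m ∈ ℕ ] Σ[ c ∈ (Fin (suc (suc (suc m))) → Fin (n G)) ]
    Injective _≡_ _≡_ c
    × (∀ (i : Fin (suc (suc m))) → E G (c (inject₁ i)) (c (suc i)))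
    × E G (c (fromℕ (suc (suc m)))) (c zero)

IsTree : Graph → Set
IsTree T = (1 ≤ n T) × Connected T × ¬ HasCycle T

record TreeDecomposition (H : Graph) (k : ℕ) : Set₁ where
  field
    T        : Graph
    isTree   : IsTree T
    bag      : Fin (n T) → Subset (n H)
    vcover   : ∀ v → ∃[ t ] (v ∈ bag t)
    ecover   : ∀ u v → E H u v → ∃[ t ] (u ∈ bag t × v ∈ bag t)
    coherent : ∀ v t t' → v ∈ bag t → v ∈ bag t' → Walk T (λ s → v ∈ bag s) t t'
    width    : ∀ t → ∣ bag t ∣ ≤ suc k

TwAtMost : Graph → ℕ → Set₁
TwAtMost H k = TreeDecomposition H k

SupTwEqOne : GraphClass → Set₁
SupTwEqOne ℋ = (∀ H → ℋ H → TwAtMost H 1)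
             × (Σ[ H ∈ Graph ] (ℋ H × ¬ TwAtMost H 0))

-- A finite family of graphs G_1,...,G_k together with homomorphisms into H;
-- equivalently a homomorphism from the disjoint union G_1 ∪̇ ... ∪̇ G_k to H.
record Family (H : Graph) : Set₁ where
  field
    k    : ℕ
    F    : Fin k → Graph
    φ    : (j : Fin k) → Fin (n (F j)) → Fin (n H)
    hom  : ∀ j → IsHom (F j) H (φ j)
open Family public

InClass : GraphClass → ∀ {H} → Family H → Set
InClass 𝒢 Φ = ∀ j → 𝒢 (F Φ j)

EdgeSurj : ∀ {H} → Family H → Set
EdgeSurj {H} Φ = ∀ u v → E H u v →
  Σ[ j ∈ Fin (k Φ) ] Σ[ x ∈ Fin (n (F Φ j)) ] Σ[ y ∈ Fin (n (F Φ j)) ]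
    (E (F Φ j) x y × φ Φ j x ≡ u × φ Φ j y ≡ v)

InjectiveOnUnion : ∀ {H} → Family H → Set
InjectiveOnUnion {H} Φ =
  Injective {A = Σ (Fin (k Φ)) (λ j → Fin (n (F Φ j)))} _≡_ _≡_
    (λ p → φ Φ (Data.Product.proj₁ p) (Data.Product.proj₂ p))

preimages : ∀ {m N} → (Fin m → Fin N) → Fin N → ℕ
preimages {m} f v = length (filter (λ x → f x ≟ v) (allFin m))

fibre : ∀ {H} → Family H → Fin (n H) → ℕ
fibre Φ v = sum (map (λ j → preimages (φ Φ j) v) (allFin (k Φ)))

LocalCover : GraphClass → Graph → ℕ → Set₁
LocalCover 𝒢 H s = Σ[ Φ ∈ Family H ]
    InClass 𝒢 Φ
  × EdgeSurj Φ
  × (∀ j → Injective _≡_ _≡_ (φ Φ j))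
  × (∀ v → fibre Φ v ≤ s)

-- Membership in the class of disjoint unions of graphs of 𝒢 is encoded by
-- giving each G_i as a family of 𝒢-graphs (G_i = disjoint union of it).
GlobalCover : GraphClass → Graph → ℕ → Set₁
GlobalCover 𝒢 H t = Σ[ Ψ ∈ (Fin t → Family H) ]
    (∀ i → InClass 𝒢 (Ψ i))
  × (∀ u v → E H u v → Σ[ i ∈ Fin t ]
        Σ[ j ∈ Fin (k (Ψ i)) ] Σ[ x ∈ Fin (n (F (Ψ i) j)) ] Σ[ y ∈ Fin (n (F (Ψ i) j)) ]
          (E (F (Ψ i) j) x y × φ (Ψ i) j x ≡ u × φ (Ψ i) j y ≡ v))
  × (∀ i → InjectiveOnUnion (Ψ i))

IsCl : GraphClass → Graph → ℕ → Set₁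
IsCl 𝒢 H s = LocalCover 𝒢 H s × (∀ s' → LocalCover 𝒢 H s' → s ≤ s')

IsCu : GraphClass → Graph → ℕ → Set₁
IsCu 𝒢 H t = GlobalCover 𝒢 H t × (∀ t' → GlobalCover 𝒢 H t' → t ≤ t')

Bounded : GraphClass → GraphClass → Set₁
Bounded 𝒢 ℋ = Σ[ f ∈ (ℕ → ℕ) ] ∀ H → ℋ H → ∀ s t → IsCl 𝒢 H s → IsCu 𝒢 H t →
  (s ≤ t × t ≤ f s)

-- H_N is a forest of double stars, one block for each unordered pair {a, b} of elements
-- of Fin N (a = b allowed), and S_N c is the union of the blocks at the pairs {c, b}.
-- The N graphs S_N c cover H_N with every vertex covered at most twice, so c_l(H_N) ≤ 2.
-- In the block at the h-th pair the hubs have 1 + p and 1 + q neighbours, where p grows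
-- with h, p + q is constant and p is much larger than q; hence an injective homomorphism
-- S_N c → H_N is forced, by degrees, to send the block of S_N c at {c, b} onto the block
-- of H_N at {c, b}.  Now take a global cover with t < N families.  The hub of {a, a} has
-- more neighbours than t families of small pieces can cover, and the sizes are chosen so
-- that every large piece is some S_N c; so some family contains S_N a.  Two copies S_N a
-- and S_N a' share the hub of {a, a'}, so they never lie in one family: t ≥ N.
-- Every H_N is a forest, of treewidth 1.

module Submission where

open import Defs
open import Algebra.Properties.CommutativeSemigroup using (interchange)
open import Axiom.UniquenessOfIdentityProofs using (module Decidable⇒UIP)
open import Data.Bool using (if_then_else_)
open import Data.Empty using (⊥; ⊥-elim)
open import Data.Fin as Fin using (Fin; zero; suc; toℕ; inject₁; inject≤; fromℕ; fromℕ<; combine; remQuot; _≟_)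
open import Data.Fin.Properties as Fin
  using ( toℕ-injective; toℕ<n; toℕ-inject₁; toℕ-inject≤; toℕ-fromℕ<; toℕ-combine; suc-injective
        ; remQuot-combine; combine-remQuot; combine-injective; injective⇒≤; any?)
open import Data.Fin.Relation.Unary.Top using (view; ‵fromℕ; ‵inject₁)
open import Data.Fin.Subset using (Subset; _∈_; ∣_∣; _∪_; ⁅_⁆; _-_; inside; outside; _⊆_)
open import Data.Fin.Subset.Properties
  using (x∈⁅x⁆; x∈⁅y⁆⇒x≡y; x∈p∪q⁺; x∈p∪q⁻; ∣⁅x⁆∣≡1; p⊆q⇒∣p∣≤∣q∣; x∈p∧x≢y⇒x∈p-y; x∈p⇒∣p-x∣<∣p∣)
open import Data.List using (length; filter; map; tabulate; allFin)
open import Data.List.Properties using (filter-none; map-tabulate)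
open import Data.List.Relation.Unary.All.Properties using (tabulate⁺)
open import Data.Nat using (ℕ; zero; suc; _≤_; _<_; z≤n; s≤s; _+_; _∸_; _*_; _≤?_; _<?_; _≤′_; ≤′-refl; ≤′-step)
open import Data.Nat.Induction using (<-wellFounded)
open import Data.Nat.ListAction using (sum)
open import Data.Nat.Properties as ℕ
  using ( ≤-refl; ≤-trans; ≤-total; ≤-reflexive; ≤-pred; <-irrefl; <-≤-trans; <-cmp; <⇒≱; ≮⇒≥; ≰⇒>; ≤⇒≤′
        ; n≤1+n; n<1+n; m≤m+n; m≤n+m; m<m+n; m≤n*m; m≤m*n; m<m*n; +-suc; +-mono-≤; +-monoʳ-≤; +-monoʳ-<
        ; *-monoˡ-≤; ∸-monoʳ-≤; ∸-monoˡ-<; m+n∸m≡n; m+[n∸m]≡n; +-cancelˡ-≡; +-commutativeSemigroup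
        ; module ≤-Reasoning)
open import Data.Product using (Σ-syntax; ∃-syntax; ∃₂; _×_; _,_; proj₁; proj₂; uncurry)
open import Data.Product.Properties using (,-injectiveʳ-UIP)
open import Data.Sum using (_⊎_; inj₁; inj₂; swap)
open import Data.Unit using (⊤; tt)
open import Data.Vec using ([]; _∷_)
open import Function using (_∘_; id)
open import Function.Definitions using (Injective)
open import Induction.WellFounded using (Acc; acc)
open import Relation.Binary using (tri<; tri≈; tri>)
open import Relation.Binary.PropositionalEquality as ≡ using (_≡_; _≢_; refl; subst; subst₂; cong; cong₂)
open import Relation.Nullary using (¬_; yes; no; does)
open import Relation.Unary using (Pred; Decidable)

-- Walks and tree decompositions

private
  variable
    G : Graph

module _ {P : Fin (n G) → Set} where

  walk-source : ∀ {u v} → Walk G P u v → P u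
  walk-source (here p)     = p
  walk-source (step p _ _) = p

  walk-++ : ∀ {u v w} → Walk G P u v → Walk G P v w → Walk G P u w
  walk-++ (here _)     q = q
  walk-++ (step p e r) q = step p e (walk-++ r q)

  walk-reverse : ∀ {u v} → Walk G P u v → Walk G P v u
  walk-reverse (here p)     = here p
  walk-reverse (step p e r) = walk-++ (walk-reverse r) (step (walk-source r) (sym G e) (here p))

∣p∪q∣≤∣p∣+∣q∣ : ∀ {m} (p q : Subset m) → ∣ p ∪ q ∣ ≤ ∣ p ∣ + ∣ q ∣
∣p∪q∣≤∣p∣+∣q∣ []            []            = z≤n
∣p∪q∣≤∣p∣+∣q∣ (outside ∷ p) (outside ∷ q) = ∣p∪q∣≤∣p∣+∣q∣ p q
∣p∪q∣≤∣p∣+∣q∣ (outside ∷ p) (inside ∷ q)  = ≤-trans (s≤s (∣p∪q∣≤∣p∣+∣q∣ p q)) (≤-reflexive (≡.sym (+-suc ∣ p ∣ ∣ q ∣)))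
∣p∪q∣≤∣p∣+∣q∣ (inside ∷ p)  (outside ∷ q) = s≤s (∣p∪q∣≤∣p∣+∣q∣ p q)
∣p∪q∣≤∣p∣+∣q∣ (inside ∷ p)  (inside ∷ q)  = s≤s (≤-trans (∣p∪q∣≤∣p∣+∣q∣ p q) (+-monoʳ-≤ ∣ p ∣ (n≤1+n ∣ q ∣)))

x∈p∧y∈p∧x≢y⇒2≤∣p∣ : ∀ {m} {x y : Fin m} {p : Subset m} → x ∈ p → y ∈ p → x ≢ y → 2 ≤ ∣ p ∣
x∈p∧y∈p∧x≢y⇒2≤∣p∣ {x = x} {y} {p} x∈p y∈p x≢y = begin
  2             ≡⟨ cong suc (≡.sym (∣⁅x⁆∣≡1 y)) ⟩
  suc ∣ ⁅ y ⁆ ∣ ≤⟨ s≤s (p⊆q⇒∣p∣≤∣q∣ ⁅y⁆⊆p-x) ⟩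
  suc ∣ p - x ∣ ≤⟨ x∈p⇒∣p-x∣<∣p∣ x∈p ⟩
  ∣ p ∣         ∎
  where
  open ≤-Reasoning
  ⁅y⁆⊆p-x : ⁅ y ⁆ ⊆ p - x
  ⁅y⁆⊆p-x z∈⁅y⁆ with refl ← x∈⁅y⁆⇒x≡y y z∈⁅y⁆ = x∈p∧x≢y⇒x∈p-y y∈p (λ y≡x → x≢y (≡.sym y≡x))

edge⇒¬tw≤0 : ∀ {u w} → E G u w → ¬ TwAtMost G 0
edge⇒¬tw≤0 {G} {u} {w} uw td with t , u∈t , w∈t ← TreeDecomposition.ecover td u w uw =
  <-irrefl refl (≤-trans (x∈p∧y∈p∧x≢y⇒2≤∣p∣ u∈t w∈t u≢w) (TreeDecomposition.width td t))
  where
  u≢w : u ≢ w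
  u≢w refl = irrefl G uw

argmax : ∀ {m} (g : Fin (suc m) → ℕ) → Σ[ i ∈ Fin (suc m) ] ∀ j → g j ≤ g i
argmax {zero}  g = zero , λ { zero → ≤-refl }
argmax {suc m} g with i , gᵢ-max ← argmax (g ∘ suc) | ≤-total (g zero) (g (suc i))
... | inj₁ g₀≤gᵢ = suc i , λ { zero → g₀≤gᵢ ; (suc j) → gᵢ-max j }
... | inj₂ gᵢ≤g₀ = zero  , λ { zero → ≤-refl ; (suc j) → ≤-trans (gᵢ-max j) gᵢ≤g₀ }


inject₁-inject₁≢suc-suc : ∀ {m} (j : Fin m) → inject₁ (inject₁ j) ≢ suc (suc j)
inject₁-inject₁≢suc-suc j eq = <-irrefl toℕ-eq (≤-trans (n<1+n (toℕ j)) (n≤1+n _))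
  where
  toℕ-eq : toℕ j ≡ suc (suc (toℕ j))
  toℕ-eq = ≡.trans (≡.sym (≡.trans (toℕ-inject₁ (inject₁ j)) (toℕ-inject₁ j))) (cong toℕ eq)

cycle-neighbours : ∀ m (c : Fin (suc (suc (suc m))) → Fin (n G)) →
  (∀ i → E G (c (inject₁ i)) (c (suc i))) → E G (c (fromℕ (suc (suc m)))) (c zero) →
  ∀ p → ∃₂ λ q q' → q ≢ q' × E G (c q) (c p) × E G (c p) (c q')
cycle-neighbours m c edge closing zero = fromℕ (suc (suc m)) , suc zero , (λ ()) , closing , edge zero
cycle-neighbours m c edge closing (suc i) with view i
... | ‵fromℕ     = inject₁ i , zero , (λ ()) , edge i , closing
... | ‵inject₁ j = inject₁ (inject₁ j) , suc (suc j) , inject₁-inject₁≢suc-suc j , edge (inject₁ j) , edge (suc j)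

-- Parent pointers towards a root; the bags {v, parent v} along the tree with edges
-- {v, parent v} form a tree decomposition of width 1.
record ParentTree (H : Graph) : Set where
  field
    root        : Fin (n H)
    parent      : Fin (n H) → Fin (n H)
    parent-root : parent root ≡ root
    parent-<    : ∀ v → v ≢ root → toℕ (parent v) < toℕ v
    edge⇒parent : ∀ {u w} → E H u w → parent u ≡ w ⊎ parent w ≡ u

module _ {H : Graph} (pt : ParentTree H) where
  open ParentTree pt

  TreeEdge : Fin (n H) → Fin (n H) → Set
  TreeEdge v w = v ≢ w × (parent v ≡ w ⊎ parent w ≡ v)

  tree : Graph
  tree = record
    { n      = n H
    ; E      = TreeEdge
    ; sym    = λ { (v≢w , e) → (λ w≡v → v≢w (≡.sym w≡v)) , swap e }
    ; irrefl = λ { (v≢v , _) → v≢v refl }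
    }

  tree-edge-down⇒parent : ∀ {v w} → TreeEdge v w → toℕ w ≤ toℕ v → parent v ≡ w
  tree-edge-down⇒parent (_   , inj₁ pv≡w) _ = pv≡w
  tree-edge-down⇒parent {v} {w} (v≢w , inj₂ pw≡v) w≤v with w ≟ root
  ... | yes refl = ⊥-elim (v≢w (≡.trans (≡.sym pw≡v) parent-root))
  ... | no w≢root = ⊥-elim (<-irrefl refl (<-≤-trans (subst (λ x → toℕ x < toℕ w) pw≡v (parent-< w w≢root)) w≤v))

  -- At the largest vertex of a cycle both cycle edges would lead to its parent.
  tree-acyclic : ¬ HasCycle tree
  tree-acyclic (m , c , c-inj , edge , closing)
    with p , p-max ← argmax (toℕ ∘ c)
    with q , q' , q≢q' , qp , pq' ← cycle-neighbours {tree} m c edge closing p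
    = q≢q' (c-inj (≡.trans (≡.sym (tree-edge-down⇒parent (sym tree qp) (p-max q)))
                           (tree-edge-down⇒parent pq' (p-max q'))))

  walk-to-root : ∀ v → Acc _<_ (toℕ v) → Walk tree (λ _ → ⊤) v root
  walk-to-root v (acc rec) with v ≟ root
  ... | yes refl = here tt
  ... | no v≢root = step tt (pv≢v , inj₁ refl) (walk-to-root (parent v) (rec (parent-< v v≢root)))
    where
    pv≢v : v ≢ parent v
    pv≢v v≡pv = <-irrefl (cong toℕ (≡.sym v≡pv)) (parent-< v v≢root)

  tree-isTree : IsTree tree
  tree-isTree = ≤-trans (s≤s z≤n) (toℕ<n root) , connected , tree-acyclic
    where
    connected : Connected tree
    connected u v = walk-++ (walk-to-root u (<-wellFounded _)) (walk-reverse (walk-to-root v (<-wellFounded _)))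

  bag : Fin (n H) → Subset (n H)
  bag v = ⁅ v ⁆ ∪ ⁅ parent v ⁆

  v∈bag-v : ∀ v → v ∈ bag v
  v∈bag-v v = x∈p∪q⁺ (inj₁ (x∈⁅x⁆ v))

  parent∈bag : ∀ v → parent v ∈ bag v
  parent∈bag v = x∈p∪q⁺ (inj₂ (x∈⁅x⁆ (parent v)))

  walk-from-bag : ∀ v t → v ∈ bag t → Walk tree (λ s → v ∈ bag s) t v
  walk-from-bag v t v∈t with t ≟ v | x∈p∪q⁻ ⁅ t ⁆ ⁅ parent t ⁆ v∈t
  ... | yes refl | _          = here v∈t
  ... | no t≢v  | inj₁ v∈⁅t⁆ = ⊥-elim (t≢v (≡.sym (x∈⁅y⁆⇒x≡y t v∈⁅t⁆)))
  ... | no t≢v  | inj₂ v∈⁅pt⁆ = step v∈t (t≢v , inj₁ (≡.sym (x∈⁅y⁆⇒x≡y (parent t) v∈⁅pt⁆))) (here (v∈bag-v v))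

  parentTree⇒tw≤1 : TwAtMost H 1
  parentTree⇒tw≤1 = record
    { T        = tree
    ; isTree   = tree-isTree
    ; bag      = bag
    ; vcover   = λ v → v , v∈bag-v v
    ; ecover   = λ u w uw → edge-in-bag (edge⇒parent uw)
    ; coherent = λ v t t' v∈t v∈t' → walk-++ (walk-from-bag v t v∈t) (walk-reverse (walk-from-bag v t' v∈t'))
    ; width    = λ t → ≤-trans (∣p∪q∣≤∣p∣+∣q∣ ⁅ t ⁆ ⁅ parent t ⁆)
                               (≤-reflexive (cong₂ _+_ (∣⁅x⁆∣≡1 t) (∣⁅x⁆∣≡1 (parent t))))
    }
    where
    edge-in-bag : ∀ {u w} → parent u ≡ w ⊎ parent w ≡ u → ∃[ t ] (u ∈ bag t × w ∈ bag t)
    edge-in-bag {u} (inj₁ refl) = u , v∈bag-v u , parent∈bag u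
    edge-in-bag {_} {w} (inj₂ refl) = w , parent∈bag w , v∈bag-v w

-- Counting preimages

module _ {a p} {A : Set a} {P : Pred A p} (P? : Decidable P) where

  length-filter-tabulate≤1 : ∀ {m} (g : Fin m → A) → (∀ i j → P (g i) → P (g j) → i ≡ j) →
                             length (filter P? (tabulate g)) ≤ 1
  length-filter-tabulate≤1 {zero}  g unique = z≤n
  length-filter-tabulate≤1 {suc m} g unique with P? (g zero)
  ... | yes P₀ = s≤s (≤-reflexive (cong length (filter-none P? (tabulate⁺ ¬P))))
    where
    ¬P : ∀ i → ¬ P (g (suc i))
    ¬P i Pᵢ with () ← unique zero (suc i) P₀ Pᵢ
  ... | no _ = length-filter-tabulate≤1 (g ∘ suc) (λ i j Pᵢ Pⱼ → suc-injective (unique (suc i) (suc j) Pᵢ Pⱼ))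

preimages-injective≤1 : ∀ {m N} {f : Fin m → Fin N} → Injective _≡_ _≡_ f → ∀ v → preimages f v ≤ 1
preimages-injective≤1 {f = f} f-inj v =
  length-filter-tabulate≤1 (λ x → f x ≟ v) id (λ i j fi≡v fj≡v → f-inj (≡.trans fi≡v (≡.sym fj≡v)))

preimages≡0 : ∀ {m N} {f : Fin m → Fin N} {v} → (∀ x → f x ≢ v) → preimages f v ≡ 0
preimages≡0 {f = f} {v} missed = cong length (filter-none (λ x → f x ≟ v) (tabulate⁺ missed))

δ : ∀ {m} → Fin m → Fin m → ℕ
δ x i = if does (i ≟ x) then 1 else 0

sum-tabulate-0 : ∀ {m} (h : Fin m → ℕ) → (∀ i → h i ≡ 0) → sum (tabulate h) ≡ 0
sum-tabulate-0 {zero}  h h≡0 = refl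
sum-tabulate-0 {suc m} h h≡0 = cong₂ _+_ (h≡0 zero) (sum-tabulate-0 (h ∘ suc) (h≡0 ∘ suc))

sum-tabulate-δ : ∀ {m} (x : Fin m) → sum (tabulate (δ x)) ≡ 1
sum-tabulate-δ {suc m} zero    = cong suc (sum-tabulate-0 (δ {suc m} zero ∘ suc) (λ _ → refl))
sum-tabulate-δ {suc m} (suc x) = sum-tabulate-δ x

sum-tabulate-mono : ∀ {m} {g h : Fin m → ℕ} → (∀ i → g i ≤ h i) → sum (tabulate g) ≤ sum (tabulate h)
sum-tabulate-mono {zero}  g≤h = z≤n
sum-tabulate-mono {suc m} g≤h = +-mono-≤ (g≤h zero) (sum-tabulate-mono (g≤h ∘ suc))

sum-tabulate-+ : ∀ {m} (g h : Fin m → ℕ) → sum (tabulate (λ i → g i + h i)) ≡ sum (tabulate g) + sum (tabulate h)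
sum-tabulate-+ {zero}  g h = refl
sum-tabulate-+ {suc m} g h = begin
  (g zero + h zero) + sum (tabulate (λ i → g (suc i) + h (suc i)))
    ≡⟨ cong ((g zero + h zero) +_) (sum-tabulate-+ (g ∘ suc) (h ∘ suc)) ⟩
  (g zero + h zero) + (sum (tabulate (g ∘ suc)) + sum (tabulate (h ∘ suc)))
    ≡⟨ interchange +-commutativeSemigroup (g zero) (h zero) _ _ ⟩
  (g zero + sum (tabulate (g ∘ suc))) + (h zero + sum (tabulate (h ∘ suc))) ∎
  where open ≡.≡-Reasoning

δ-diag : ∀ {m} (x : Fin m) → δ x x ≡ 1
δ-diag x with x ≟ x
... | yes _   = refl
... | no  x≢x = ⊥-elim (x≢x refl)

-- Degrees and covers

induced : (H : Graph) {m : ℕ} → (Fin m → Fin (n H)) → Graph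
induced H {m} f = record
  { n = m ; E = λ x y → E H (f x) (f y) ; sym = sym H ; irrefl = irrefl H }

-- ν lists every neighbour of x, possibly with repetitions.
Degree≤ : (G : Graph) → Fin (n G) → ℕ → Set
Degree≤ G x D = Σ[ ν ∈ (Fin D → Fin (n G)) ] ∀ w → E G x w → ∃[ k ] ν k ≡ w

Degree≥ : (G : Graph) → Fin (n G) → ℕ → Set
Degree≥ G x d = Σ[ ν ∈ (Fin d → Fin (n G)) ] Injective _≡_ _≡_ ν × ∀ k → E G x (ν k)

injective-hom-degree : ∀ {G H ψ x d D} → IsHom G H ψ → Injective _≡_ _≡_ ψ →
                       Degree≥ G x d → Degree≤ H (ψ x) D → d ≤ D
injective-hom-degree {G} {H} {ψ} {x} hom ψ-inj (ν , ν-inj , ν-adj) (μ , μ-cover) =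
  Fin.injective⇒≤ {f = index} (λ {k} {k'} eq → ν-inj (ψ-inj (begin
    ψ (ν k)           ≡⟨ proj₂ (lookup k) ⟨
    μ (index k)       ≡⟨ cong μ eq ⟩
    μ (index k')      ≡⟨ proj₂ (lookup k') ⟩
    ψ (ν k')          ∎)))
  where
  open ≡.≡-Reasoning
  lookup : ∀ k → ∃[ j ] μ j ≡ ψ (ν k)
  lookup k = μ-cover (ψ (ν k)) (hom x (ν k) (ν-adj k))
  index = λ k → proj₁ (lookup k)

¬¬-minimum : ∀ {ℓ} (P : ℕ → Set ℓ) {m} → P m → ¬ ¬ (∃[ k ] P k × ∀ k' → P k' → k ≤ k')
¬¬-minimum P {m} Pm = below m (<-wellFounded m) Pm
  where
  below : ∀ m → Acc _<_ m → P m → ¬ ¬ (∃[ k ] P k × ∀ k' → P k' → k ≤ k')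
  below m (acc smaller) Pm no-min =
    no-min (m , Pm , λ k' Pk' → ≮⇒≥ (λ k'<m → below k' (smaller k'<m) Pk' no-min))

CoveredBy : ∀ {H} → Family H → Fin (n H) → Fin (n H) → Set
CoveredBy Φ u v = Σ[ j ∈ Fin (k Φ) ] Σ[ x ∈ Fin (n (F Φ j)) ] Σ[ y ∈ Fin (n (F Φ j)) ]
  (E (F Φ j) x y × φ Φ j x ≡ u × φ Φ j y ≡ v)

local⇒global : ∀ {𝒢 H s} → LocalCover 𝒢 H s → ∃[ t ] GlobalCover 𝒢 H t
local⇒global {𝒢} {H} (Φ , in𝒢 , covers , injective , _) =
  k Φ , singleton , (λ i _ → in𝒢 i) , cover , singleton-injective
  where
  singleton : Fin (k Φ) → Family H
  singleton j = record { k = 1 ; F = λ _ → F Φ j ; φ = λ _ → φ Φ j ; hom = λ _ → hom Φ j }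
  cover : ∀ u v → E H u v → Σ[ i ∈ Fin (k Φ) ] CoveredBy (singleton i) u v
  cover u v uv with j , x , y , xy , x↦u , y↦v ← covers u v uv = j , zero , x , y , xy , x↦u , y↦v
  singleton-injective : ∀ i → InjectiveOnUnion (singleton i)
  singleton-injective i {zero , x} {zero , y} eq = cong (zero ,_) (injective i eq)

injectiveOnUnion⇒injective : ∀ {H} {Φ : Family H} → InjectiveOnUnion Φ → ∀ j → Injective _≡_ _≡_ (φ Φ j)
injectiveOnUnion⇒injective injective j eq = ,-injectiveʳ-UIP (Decidable⇒UIP.≡-irrelevant _≟_) (injective eq)

module _ {H : Graph} {t : ℕ} (Ψ : Fin t → Family H)
         (cover : ∀ u v → E H u v → Σ[ i ∈ Fin t ] CoveredBy (Ψ i) u v)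
         (injective : ∀ i → InjectiveOnUnion (Ψ i)) where

  Covering : Fin (n H) → Fin (n H) → Set
  Covering u w = Σ[ i ∈ Fin t ] CoveredBy (Ψ i) u w

  pieceSize : ∀ {u w} → Covering u w → ℕ
  pieceSize (i , j , _) = n (F (Ψ i) j)

  endpoint : ∀ {u w} → Covering u w → ℕ
  endpoint (_ , _ , _ , y , _) = toℕ y

  endpoint<pieceSize : ∀ {u w} (s : Covering u w) → endpoint s < pieceSize s
  endpoint<pieceSize (_ , _ , _ , y , _) = toℕ<n y

  -- u has a single preimage in the union of family i, so the endpoint there determines the edge.
  covering-unique : ∀ {u w w'} (s : Covering u w) (s' : Covering u w') →
                    proj₁ s ≡ proj₁ s' → endpoint s ≡ endpoint s' → w ≡ w'
  covering-unique (i , j , x , y , _ , x↦u , y↦w) (.i , j' , x' , y' , _ , x'↦u , y'↦w') refl y≡y'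
    with refl ← injective i (≡.trans x↦u (≡.sym x'↦u))
    = ≡.trans (≡.sym y↦w) (≡.trans (cong (φ (Ψ i) j) (toℕ-injective y≡y')) y'↦w')

  LargePieceAt : Fin (n H) → ℕ → Set
  LargePieceAt u m = Σ[ i ∈ Fin t ] Σ[ j ∈ Fin (k (Ψ i)) ] Σ[ x ∈ Fin (n (F (Ψ i) j)) ]
    (φ (Ψ i) j x ≡ u × m ≤ n (F (Ψ i) j))

  -- Pigeonhole: t families whose pieces have fewer than m vertices cover at most t·m edges at u.
  large-piece-at : ∀ {u d} → Degree≥ H u d → ∀ m → t * m < d → LargePieceAt u m
  large-piece-at {u} {d} (ν , ν-injective , ν-adj) m tm<d with any? (λ k → m ≤? pieceSize (cover u (ν k) (ν-adj k)))
  ... | yes (k , large) with i , j , x , _ , _ , x↦u , _ ← cover u (ν k) (ν-adj k) = i , j , x , x↦u , large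
  ... | no  none        = ⊥-elim (<⇒≱ tm<d (injective⇒≤ code-injective))
    where
    covering : ∀ k → Covering u (ν k)
    covering k = cover u (ν k) (ν-adj k)
    endpoint<m : ∀ k → endpoint (covering k) < m
    endpoint<m k = <-≤-trans (endpoint<pieceSize (covering k)) (ℕ.<⇒≤ (≰⇒> (λ m≤size → none (k , m≤size))))
    code : Fin d → Fin (t * m)
    code k = combine (proj₁ (covering k)) (fromℕ< (endpoint<m k))
    code-injective : Injective _≡_ _≡_ code
    code-injective {k} {k'} eq with same-family , same-endpoint ← combine-injective _ _ _ _ eq =
      ν-injective (covering-unique (covering k) (covering k') same-family (begin
        endpoint (covering k)                ≡⟨ toℕ-fromℕ< (endpoint<m k) ⟨
        toℕ (fromℕ< (endpoint<m k))          ≡⟨ cong toℕ same-endpoint ⟩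
        toℕ (fromℕ< (endpoint<m k'))         ≡⟨ toℕ-fromℕ< (endpoint<m k') ⟩
        endpoint (covering k')               ∎))
      where open ≡.≡-Reasoning

-- Double stars and the sizes of the construction

-- A double star on Fin (2 + K): two adjacent hubs, and K leaves of which
-- leaf ℓ hangs at hubᵤ if ℓ < p and at hubᵥ otherwise.
pattern hubᵤ   = zero
pattern hubᵥ   = suc zero
pattern leaf ℓ = suc (suc ℓ)

DoubleStarAdj : ∀ {K} → ℕ → Fin (2 + K) → Fin (2 + K) → Set
DoubleStarAdj p hubᵤ     hubᵥ     = ⊤
DoubleStarAdj p hubᵥ     hubᵤ     = ⊤
DoubleStarAdj p hubᵤ     (leaf ℓ) = toℕ ℓ < p
DoubleStarAdj p (leaf ℓ) hubᵤ     = toℕ ℓ < p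
DoubleStarAdj p hubᵥ     (leaf ℓ) = p ≤ toℕ ℓ
DoubleStarAdj p (leaf ℓ) hubᵥ     = p ≤ toℕ ℓ
DoubleStarAdj p hubᵤ     hubᵤ     = ⊥
DoubleStarAdj p hubᵥ     hubᵥ     = ⊥
DoubleStarAdj p (leaf _) (leaf _) = ⊥

DoubleStarAdj-sym : ∀ {K} p {l l' : Fin (2 + K)} → DoubleStarAdj p l l' → DoubleStarAdj p l' l
DoubleStarAdj-sym p {hubᵤ}   {hubᵥ}   a = a
DoubleStarAdj-sym p {hubᵥ}   {hubᵤ}   a = a
DoubleStarAdj-sym p {hubᵤ}   {leaf _} a = a
DoubleStarAdj-sym p {leaf _} {hubᵤ}   a = a
DoubleStarAdj-sym p {hubᵥ}   {leaf _} a = a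
DoubleStarAdj-sym p {leaf _} {hubᵥ}   a = a

DoubleStarAdj-irrefl : ∀ {K} p {l : Fin (2 + K)} → ¬ DoubleStarAdj p l l
DoubleStarAdj-irrefl p {hubᵤ}   ()
DoubleStarAdj-irrefl p {hubᵥ}   ()
DoubleStarAdj-irrefl p {leaf _} ()

module DoubleStar (K p : ℕ) (p≤K : p ≤ K) where

  Loc : Set
  Loc = Fin (2 + K)

  q : ℕ
  q = K ∸ p

  p+k<K : (k : Fin q) → p + toℕ k < K
  p+k<K k = subst (p + toℕ k <_) (m+[n∸m]≡n p≤K) (+-monoʳ-< p (toℕ<n k))

  hubᵤ-nbr : Fin (suc p) → Loc
  hubᵤ-nbr zero    = hubᵥ
  hubᵤ-nbr (suc k) = leaf (inject≤ k p≤K)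

  hubᵥ-nbr : Fin (suc q) → Loc
  hubᵥ-nbr zero    = hubᵤ
  hubᵥ-nbr (suc k) = leaf (fromℕ< (p+k<K k))

  side : Fin K → Loc
  side ℓ with toℕ ℓ <? p
  ... | yes _ = hubᵤ
  ... | no  _ = hubᵥ

  hubᵤ-nbr-adj : ∀ k → DoubleStarAdj p hubᵤ (hubᵤ-nbr k)
  hubᵤ-nbr-adj zero    = tt
  hubᵤ-nbr-adj (suc k) = subst (_< p) (≡.sym (toℕ-inject≤ k p≤K)) (toℕ<n k)

  hubᵥ-nbr-adj : ∀ k → DoubleStarAdj p hubᵥ (hubᵥ-nbr k)
  hubᵥ-nbr-adj zero    = tt
  hubᵥ-nbr-adj (suc k) = subst (p ≤_) (≡.sym (toℕ-fromℕ< (p+k<K k))) (m≤m+n p (toℕ k))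

  side-adj : ∀ ℓ → DoubleStarAdj p (leaf ℓ) (side ℓ)
  side-adj ℓ with toℕ ℓ <? p
  ... | yes ℓ<p = ℓ<p
  ... | no  ℓ≮p = ≮⇒≥ ℓ≮p

  side-hub : ∀ ℓ → side ℓ ≡ hubᵤ ⊎ side ℓ ≡ hubᵥ
  side-hub ℓ with toℕ ℓ <? p
  ... | yes _ = inj₁ refl
  ... | no  _ = inj₂ refl

  hubᵤ-nbr-injective : Injective _≡_ _≡_ hubᵤ-nbr
  hubᵤ-nbr-injective {zero}  {zero}  _ = refl
  hubᵤ-nbr-injective {suc x} {suc y} e = cong suc (toℕ-injective (begin
    toℕ x                 ≡⟨ toℕ-inject≤ x p≤K ⟨
    toℕ (inject≤ x p≤K)   ≡⟨ cong toℕ (suc-injective (suc-injective e)) ⟩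
    toℕ (inject≤ y p≤K)   ≡⟨ toℕ-inject≤ y p≤K ⟩
    toℕ y                 ∎))
    where open ≡.≡-Reasoning

  hubᵥ-nbr-injective : Injective _≡_ _≡_ hubᵥ-nbr
  hubᵥ-nbr-injective {zero}  {zero}  _ = refl
  hubᵥ-nbr-injective {suc x} {suc y} e = cong suc (toℕ-injective (+-cancelˡ-≡ p _ _ (begin
    p + toℕ x                  ≡⟨ toℕ-fromℕ< (p+k<K x) ⟨
    toℕ (fromℕ< (p+k<K x))     ≡⟨ cong toℕ (suc-injective (suc-injective e)) ⟩
    toℕ (fromℕ< (p+k<K y))     ≡⟨ toℕ-fromℕ< (p+k<K y) ⟩
    p + toℕ y                  ∎)))
    where open ≡.≡-Reasoning

  hubᵤ-nbr-complete : ∀ l → DoubleStarAdj p hubᵤ l → ∃[ k ] hubᵤ-nbr k ≡ l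
  hubᵤ-nbr-complete hubᵥ     _   = zero , refl
  hubᵤ-nbr-complete (leaf ℓ) ℓ<p = suc (fromℕ< ℓ<p) , cong leaf (toℕ-injective
    (≡.trans (toℕ-inject≤ (fromℕ< ℓ<p) p≤K) (toℕ-fromℕ< ℓ<p)))

  hubᵥ-nbr-complete : ∀ l → DoubleStarAdj p hubᵥ l → ∃[ k ] hubᵥ-nbr k ≡ l
  hubᵥ-nbr-complete hubᵤ     _   = zero , refl
  hubᵥ-nbr-complete (leaf ℓ) p≤ℓ = suc (fromℕ< ℓ∸p<q) , cong leaf (toℕ-injective (begin
    toℕ (fromℕ< (p+k<K (fromℕ< ℓ∸p<q)))  ≡⟨ toℕ-fromℕ< (p+k<K (fromℕ< ℓ∸p<q)) ⟩
    p + toℕ (fromℕ< ℓ∸p<q)               ≡⟨ cong (p +_) (toℕ-fromℕ< ℓ∸p<q) ⟩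
    p + (toℕ ℓ ∸ p)                       ≡⟨ m+[n∸m]≡n p≤ℓ ⟩
    toℕ ℓ                                 ∎))
    where
    open ≡.≡-Reasoning
    ℓ∸p<q : toℕ ℓ ∸ p < q
    ℓ∸p<q = ∸-monoˡ-< (toℕ<n ℓ) p≤ℓ

  leaf-nbr-unique : ∀ ℓ l → DoubleStarAdj p (leaf ℓ) l → side ℓ ≡ l
  leaf-nbr-unique ℓ hubᵤ ℓ<p with toℕ ℓ <? p
  ... | yes _   = refl
  ... | no  ℓ≮p = ⊥-elim (ℓ≮p ℓ<p)
  leaf-nbr-unique ℓ hubᵥ p≤ℓ with toℕ ℓ <? p
  ... | yes ℓ<p = ⊥-elim (<⇒≱ ℓ<p p≤ℓ)
  ... | no  _   = refl

-- H_N has order N vertices in N * N blocks of blockSize N, and S_N c has starOrder N.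
-- K₂ and every S_M c with M < N have fewer than θ N vertices, while every S_M c with
-- M > N has more vertices than H_N.
θ : ℕ → ℕ
θ zero    = 3
θ (suc N) = N * N * (2 + (N * N * θ N + N * N)) + 3

minULeaves : ℕ → ℕ
minULeaves N = N * N * θ N

leafCount : ℕ → ℕ
leafCount N = minULeaves N + N * N

blockSize : ℕ → ℕ
blockSize N = 2 + leafCount N

order : ℕ → ℕ
order N = N * N * blockSize N

starOrder : ℕ → ℕ
starOrder N = N * blockSize N

3≤θ : ∀ N → 3 ≤ θ N
3≤θ zero    = ≤-refl
3≤θ (suc N) = m≤n+m 3 (order N)

θ≤blockSize : ∀ N → θ (suc N) ≤ blockSize (suc N)
θ≤blockSize N = begin
  θ (suc N)                     ≤⟨ m≤n*m (θ (suc N)) (suc N * suc N) ⟩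
  minULeaves (suc N)                ≤⟨ m≤m+n _ _ ⟩
  leafCount (suc N)             ≤⟨ m≤n+m _ 2 ⟩
  blockSize (suc N)             ∎
  where open ≤-Reasoning

starOrder≤order : ∀ N → starOrder N ≤ order N
starOrder≤order zero    = z≤n
starOrder≤order (suc N) = *-monoˡ-≤ (blockSize (suc N)) (m≤m*n (suc N) (suc N))

θ≤θ-suc : ∀ N → θ N ≤ θ (suc N)
θ≤θ-suc zero    = ≤-refl
θ≤θ-suc (suc N) = begin
  θ (suc N)                     ≤⟨ θ≤blockSize N ⟩
  blockSize (suc N)             ≤⟨ m≤n*m _ (suc N) ⟩
  starOrder (suc N)             ≤⟨ starOrder≤order (suc N) ⟩
  order (suc N)                 ≤⟨ m≤m+n _ 3 ⟩
  θ (suc (suc N))               ∎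
  where open ≤-Reasoning

θ-mono : ∀ {N M} → N ≤′ M → θ N ≤ θ M
θ-mono ≤′-refl           = ≤-refl
θ-mono {M = suc M} (≤′-step N≤M) = ≤-trans (θ-mono N≤M) (θ≤θ-suc M)

starOrder<θ : ∀ {N' N} → N' < N → starOrder N' < θ N
starOrder<θ {N'} {N} N'<N = begin-strict
  starOrder N'                  ≤⟨ starOrder≤order N' ⟩
  order N'                      <⟨ m<m+n (order N') (s≤s z≤n) ⟩
  θ (suc N')                    ≤⟨ θ-mono (≤⇒≤′ N'<N) ⟩
  θ N                           ∎
  where open ≤-Reasoning

order<starOrder : ∀ {N N'} → N < N' → order N < starOrder N'
order<starOrder {N} {suc M} (s≤s N≤M) = begin-strict
  order N                       <⟨ m<m+n (order N) (s≤s z≤n) ⟩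
  θ (suc N)                     ≤⟨ θ-mono (≤⇒≤′ (s≤s N≤M)) ⟩
  θ (suc M)                     ≤⟨ θ≤blockSize M ⟩
  blockSize (suc M)             ≤⟨ m≤n*m _ (suc M) ⟩
  starOrder (suc M)             ∎
  where open ≤-Reasoning

N²<minULeaves : ∀ {N} → 0 < N → N * N < minULeaves N
N²<minULeaves {suc M} _ = m<m*n (suc M * suc M) (θ (suc M)) (ℕ.≤-trans (s≤s (s≤s z≤n)) (3≤θ (suc M)))

t*θ≤minULeaves : ∀ {t N} → t ≤ N → t * θ N ≤ minULeaves N
t*θ≤minULeaves {N = zero}  z≤n = z≤n
t*θ≤minULeaves {N = suc M} t≤N = *-monoˡ-≤ (θ (suc M)) (≤-trans t≤N (m≤m*n (suc M) (suc M)))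

-- The graphs H_N and S_N c

module Construction (N : ℕ) where

  Slot = Fin (N * N)
  Loc  = Fin (blockSize N)
  V    = Fin (order N)

  ⟨_,_⟩ : Slot → Loc → V
  ⟨ h , l ⟩ = combine h l

  slot : V → Slot
  slot v = proj₁ (remQuot {N * N} (blockSize N) v)

  loc : V → Loc
  loc v = proj₂ (remQuot {N * N} (blockSize N) v)

  slot-⟨⟩ : ∀ h l → slot ⟨ h , l ⟩ ≡ h
  slot-⟨⟩ h l = cong proj₁ (remQuot-combine h l)

  loc-⟨⟩ : ∀ h l → loc ⟨ h , l ⟩ ≡ l
  loc-⟨⟩ h l = cong proj₂ (remQuot-combine h l)

  ⟨⟩-elim : (P : V → Set) → (∀ h l → P ⟨ h , l ⟩) → ∀ v → P v
  ⟨⟩-elim P P⟨⟩ v = subst P (combine-remQuot {N * N} (blockSize N) v) (P⟨⟩ (slot v) (loc v))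

  -- Slot combine a b stands for the pair {a, b}; only the slots with a ≤ b are used.
  Used : Slot → Set
  Used h = uncurry Fin._≤_ (remQuot {N} N h)

  uLeaves : Slot → ℕ
  uLeaves h = minULeaves N + toℕ h

  uLeaves≤leafCount : ∀ h → uLeaves h ≤ leafCount N
  uLeaves≤leafCount h = +-monoʳ-≤ (minULeaves N) (ℕ.<⇒≤ (toℕ<n h))

  module Block (h : Slot) = DoubleStar (leafCount N) (uLeaves h) (uLeaves≤leafCount h)

  Adjacent : V → V → Set
  Adjacent v w = slot v ≡ slot w × Used (slot v) × DoubleStarAdj (uLeaves (slot v)) (loc v) (loc w)

  H : Graph
  H = record
    { n      = order N
    ; E      = Adjacent
    ; sym    = λ { {v} {w} (s≡ , used , a) → ≡.sym s≡ , subst Used s≡ used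
                 , subst (λ h → DoubleStarAdj (uLeaves h) (loc w) (loc v)) s≡ (DoubleStarAdj-sym _ a) }
    ; irrefl = λ (_ , _ , a) → DoubleStarAdj-irrefl _ a
    }

  adjacent⁺ : ∀ {h l l'} → Used h → DoubleStarAdj (uLeaves h) l l' → Adjacent ⟨ h , l ⟩ ⟨ h , l' ⟩
  adjacent⁺ {h} {l} {l'} used a rewrite slot-⟨⟩ h l | slot-⟨⟩ h l' | loc-⟨⟩ h l | loc-⟨⟩ h l' = refl , used , a

  adjacent-slot : ∀ {h l w} → Adjacent ⟨ h , l ⟩ w → h ≡ slot w × Used h × DoubleStarAdj (uLeaves h) l (loc w)
  adjacent-slot {h} {l} adj rewrite slot-⟨⟩ h l | loc-⟨⟩ h l = adj

  adjacent⁻ : ∀ {h l w} → Adjacent ⟨ h , l ⟩ w → ∃[ l' ] w ≡ ⟨ h , l' ⟩ × Used h × DoubleStarAdj (uLeaves h) l l'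
  adjacent⁻ {h} {l} {w} adj with h≡slot , used , a ← adjacent-slot adj =
    loc w , ≡.trans (≡.sym (combine-remQuot {N * N} (blockSize N) w)) (cong ⟨_, loc w ⟩ (≡.sym h≡slot)) , used , a

  pairSlot : Fin N → Fin N → Slot
  pairSlot a b with a Fin.≤? b
  ... | yes _ = combine a b
  ... | no  _ = combine b a

  pairSlot-used : ∀ a b → Used (pairSlot a b)
  pairSlot-used a b with a Fin.≤? b
  ... | yes a≤b = subst (uncurry Fin._≤_) (≡.sym (remQuot-combine a b)) a≤b
  ... | no  a≰b = subst (uncurry Fin._≤_) (≡.sym (remQuot-combine b a)) (ℕ.<⇒≤ (ℕ.≰⇒> a≰b))

  pairSlot-comm : ∀ a b → pairSlot a b ≡ pairSlot b a
  pairSlot-comm a b with a Fin.≤? b | b Fin.≤? a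
  ... | yes a≤b | yes b≤a with refl ← Fin.≤-antisym a≤b b≤a = refl
  ... | yes _   | no  _   = refl
  ... | no  _   | yes _   = refl
  ... | no  a≰b | no  b≰a = ⊥-elim (a≰b (ℕ.<⇒≤ (ℕ.≰⇒> b≰a)))

  pairSlot-member : ∀ c b a a' → pairSlot c b ≡ pairSlot a a' → c ≡ a ⊎ c ≡ a'
  pairSlot-member c b a a' eq with c Fin.≤? b | a Fin.≤? a'
  ... | yes _ | yes _ = inj₁ (proj₁ (combine-injective c b a a' eq))
  ... | yes _ | no  _ = inj₂ (proj₁ (combine-injective c b a' a eq))
  ... | no  _ | yes _ = inj₂ (proj₂ (combine-injective b c a a' eq))
  ... | no  _ | no  _ = inj₁ (proj₂ (combine-injective b c a' a eq))

  pairSlot-injectiveʳ : ∀ c {b b'} → pairSlot c b ≡ pairSlot c b' → b ≡ b'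
  pairSlot-injectiveʳ c {b} {b'} eq with c Fin.≤? b | c Fin.≤? b'
  ... | yes _ | yes _ = proj₂ (combine-injective c b c b' eq)
  ... | yes _ | no  _ = ≡.trans (proj₂ (combine-injective c b b' c eq)) (proj₁ (combine-injective c b b' c eq))
  ... | no  _ | yes _ = ≡.trans (proj₁ (combine-injective b c c b' eq)) (proj₂ (combine-injective b c c b' eq))
  ... | no  _ | no  _ = proj₁ (combine-injective b c b' c eq)

  pairSlot-remQuot : ∀ h → Used h → pairSlot (proj₁ (remQuot {N} N h)) (proj₂ (remQuot {N} N h)) ≡ h
  pairSlot-remQuot h used with proj₁ (remQuot {N} N h) Fin.≤? proj₂ (remQuot {N} N h)
  ... | yes _   = combine-remQuot {N} N h
  ... | no  a≰b = ⊥-elim (a≰b used)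

  StarV = Fin (starOrder N)

  ⟪_,_⟫ : Fin N → Loc → StarV
  ⟪ b , l ⟫ = combine b l

  branch : StarV → Fin N
  branch x = proj₁ (remQuot {N} (blockSize N) x)

  branchLoc : StarV → Loc
  branchLoc x = proj₂ (remQuot {N} (blockSize N) x)

  ⟪⟫-elim : (P : StarV → Set) → (∀ b l → P ⟪ b , l ⟫) → ∀ x → P x
  ⟪⟫-elim P P⟪⟫ x = subst P (combine-remQuot {N} (blockSize N) x) (P⟪⟫ (branch x) (branchLoc x))

  ⟪⟫-injectiveʳ : ∀ {b l l'} → ⟪ b , l ⟫ ≡ ⟪ b , l' ⟫ → l ≡ l'
  ⟪⟫-injectiveʳ {b} {l} {l'} eq = proj₂ (combine-injective b l b l' eq)

  -- S c is the union of the blocks of H at the slots {c, b}, b ∈ Fin N.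
  embed : Fin N → StarV → V
  embed c x = ⟨ pairSlot c (branch x) , branchLoc x ⟩

  embed-⟪⟫ : ∀ c b l → embed c ⟪ b , l ⟫ ≡ ⟨ pairSlot c b , l ⟩
  embed-⟪⟫ c b l = cong (λ (b , l) → ⟨ pairSlot c b , l ⟩) (remQuot-combine b l)

  embed-injective : ∀ c → Injective _≡_ _≡_ (embed c)
  embed-injective c {x} {y} eq with combine-injective (pairSlot c (branch x)) _ (pairSlot c (branch y)) _ eq
  ... | same-slot , same-loc = begin
    x                          ≡⟨ combine-remQuot {N} (blockSize N) x ⟨
    ⟪ branch x , branchLoc x ⟫ ≡⟨ cong₂ ⟪_,_⟫ (pairSlot-injectiveʳ c same-slot) same-loc ⟩
    ⟪ branch y , branchLoc y ⟫ ≡⟨ combine-remQuot {N} (blockSize N) y ⟩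
    y                          ∎
    where open ≡.≡-Reasoning

  slotPair : V → Fin N × Fin N
  slotPair v = remQuot {N} N (slot v)

  embed-hits : ∀ a z {v} → embed a z ≡ v → a ≡ proj₁ (slotPair v) ⊎ a ≡ proj₂ (slotPair v)
  embed-hits a z {v} hit = pairSlot-member a (branch z) (proj₁ (slotPair v)) (proj₂ (slotPair v)) (≡.trans slot≡ (≡.sym (pairSlot-remQuot (slot v) used)))
    where
    slot≡ : pairSlot a (branch z) ≡ slot v
    slot≡ = ≡.trans (≡.sym (slot-⟨⟩ _ _)) (cong slot hit)
    used : Used (slot v)
    used = subst Used slot≡ (pairSlot-used a (branch z))

  S : Fin N → Graph
  S c = induced H (embed c)

  star-adjacent : ∀ c b {l l'} → DoubleStarAdj (uLeaves (pairSlot c b)) l l' → E (S c) ⟪ b , l ⟫ ⟪ b , l' ⟫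
  star-adjacent c b {l} {l'} a =
    subst₂ Adjacent (≡.sym (embed-⟪⟫ c b l)) (≡.sym (embed-⟪⟫ c b l')) (adjacent⁺ (pairSlot-used c b) a)

  vLeaves : Slot → ℕ
  vLeaves = Block.q

  0<vLeaves : ∀ h → 0 < vLeaves h
  0<vLeaves h = ℕ.m<n⇒0<n∸m (+-monoʳ-< (minULeaves N) (toℕ<n h))

  vLeaves≤N² : ∀ h → vLeaves h ≤ N * N
  vLeaves≤N² h = begin
    leafCount N ∸ uLeaves h   ≤⟨ ∸-monoʳ-≤ (leafCount N) (m≤m+n (minULeaves N) (toℕ h)) ⟩
    leafCount N ∸ minULeaves N    ≡⟨ m+n∸m≡n (minULeaves N) (N * N) ⟩
    N * N                     ∎
    where open ≤-Reasoning

  -- uLeaves h + vLeaves h = leafCount N, and uLeaves is injective.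
  leaves-determine-slot : ∀ {h g} → uLeaves h ≤ uLeaves g → vLeaves h ≤ vLeaves g → h ≡ g
  leaves-determine-slot {h} {g} uh≤ug vh≤vg = toℕ-injective (ℕ.+-cancelˡ-≡ (minULeaves N) _ _
    (ℕ.≤-antisym uh≤ug (ℕ.∸-cancelʳ-≤ (uLeaves≤leafCount g) vh≤vg)))

  hubᵤ-degree≤ : ∀ g → Degree≤ H ⟨ g , hubᵤ ⟩ (suc (uLeaves g))
  hubᵤ-degree≤ g = (λ k → ⟨ g , Block.hubᵤ-nbr g k ⟩) , cover
    where
    cover : ∀ w → Adjacent ⟨ g , hubᵤ ⟩ w → ∃[ k ] ⟨ g , Block.hubᵤ-nbr g k ⟩ ≡ w
    cover w adj with l , refl , _ , a ← adjacent⁻ adj with k , refl ← Block.hubᵤ-nbr-complete g l a = k , refl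

  hubᵥ-degree≤ : ∀ g → Degree≤ H ⟨ g , hubᵥ ⟩ (suc (vLeaves g))
  hubᵥ-degree≤ g = (λ k → ⟨ g , Block.hubᵥ-nbr g k ⟩) , cover
    where
    cover : ∀ w → Adjacent ⟨ g , hubᵥ ⟩ w → ∃[ k ] ⟨ g , Block.hubᵥ-nbr g k ⟩ ≡ w
    cover w adj with l , refl , _ , a ← adjacent⁻ adj with k , refl ← Block.hubᵥ-nbr-complete g l a = k , refl

  leaf-degree≤ : ∀ g ℓ → Degree≤ H ⟨ g , leaf ℓ ⟩ 1
  leaf-degree≤ g ℓ = (λ _ → ⟨ g , Block.side g ℓ ⟩) , cover
    where
    cover : ∀ w → Adjacent ⟨ g , leaf ℓ ⟩ w → ∃[ k ] ⟨ g , Block.side g ℓ ⟩ ≡ w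
    cover w adj with l , refl , _ , a ← adjacent⁻ adj = zero , cong ⟨ g ,_⟩ (Block.leaf-nbr-unique g ℓ l a)

  hubᵤ-or-degree≤ : ∀ v → (∃[ g ] v ≡ ⟨ g , hubᵤ ⟩) ⊎ (∃[ D ] D ≤ suc (N * N) × Degree≤ H v D)
  hubᵤ-or-degree≤ = ⟨⟩-elim _ by-loc
    where
    by-loc : ∀ g l → (∃[ g' ] ⟨ g , l ⟩ ≡ ⟨ g' , hubᵤ ⟩) ⊎ (∃[ D ] D ≤ suc (N * N) × Degree≤ H ⟨ g , l ⟩ D)
    by-loc g l with proj₁ (remQuot {N} N g) Fin.≤? proj₂ (remQuot {N} N g)
    by-loc g l        | no unused = inj₂ (0 , z≤n , (λ ()) , λ w adj → ⊥-elim (unused (proj₁ (proj₂ (adjacent-slot adj)))))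
    by-loc g hubᵤ     | yes _ = inj₁ (g , refl)
    by-loc g hubᵥ     | yes _ = inj₂ (suc (vLeaves g) , s≤s (vLeaves≤N² g) , hubᵥ-degree≤ g)
    by-loc g (leaf ℓ) | yes _ = inj₂ (1 , s≤s z≤n , leaf-degree≤ g ℓ)

  star-hubᵤ-degree≥ : ∀ c b → Degree≥ (S c) ⟪ b , hubᵤ ⟫ (suc (uLeaves (pairSlot c b)))
  star-hubᵤ-degree≥ c b =
      (λ k → ⟪ b , Block.hubᵤ-nbr (pairSlot c b) k ⟫)
    , Block.hubᵤ-nbr-injective (pairSlot c b) ∘ ⟪⟫-injectiveʳ
    , star-adjacent c b ∘ Block.hubᵤ-nbr-adj (pairSlot c b)

  star-hubᵥ-degree≥ : ∀ c b → Degree≥ (S c) ⟪ b , hubᵥ ⟫ (suc (vLeaves (pairSlot c b)))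
  star-hubᵥ-degree≥ c b =
      (λ k → ⟪ b , Block.hubᵥ-nbr (pairSlot c b) k ⟫)
    , Block.hubᵥ-nbr-injective (pairSlot c b) ∘ ⟪⟫-injectiveʳ
    , star-adjacent c b ∘ Block.hubᵥ-nbr-adj (pairSlot c b)

  t*θ<1+uLeaves : ∀ {t} → t ≤ N → ∀ h → t * θ N < suc (uLeaves h)
  t*θ<1+uLeaves t≤N h = s≤s (≤-trans (t*θ≤minULeaves t≤N) (m≤m+n _ _))

  hubᵤ-degree≥ : ∀ {g} → Used g → Degree≥ H ⟨ g , hubᵤ ⟩ (suc (uLeaves g))
  hubᵤ-degree≥ {g} used =
      (λ k → ⟨ g , Block.hubᵤ-nbr g k ⟩)
    , (λ {k} {k'} eq → Block.hubᵤ-nbr-injective g (proj₂ (combine-injective g _ g _ eq)))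
    , (λ k → adjacent⁺ used (Block.hubᵤ-nbr-adj g k))

module Treewidth (N₀ : ℕ) where
  open Construction (suc N₀)

  root : V
  root = ⟨ zero , hubᵤ ⟩

  blockParent : Slot → Loc → V
  blockParent h hubᵤ     = root
  blockParent h hubᵥ     = ⟨ h , hubᵤ ⟩
  blockParent h (leaf ℓ) = ⟨ h , Block.side h ℓ ⟩

  parent : V → V
  parent v = blockParent (slot v) (loc v)

  parent-⟨⟩ : ∀ h l → parent ⟨ h , l ⟩ ≡ blockParent h l
  parent-⟨⟩ h l = cong₂ blockParent (slot-⟨⟩ h l) (loc-⟨⟩ h l)

  ⟨⟩-monoʳ-< : ∀ h {l l'} → toℕ l < toℕ l' → toℕ ⟨ h , l ⟩ < toℕ ⟨ h , l' ⟩
  ⟨⟩-monoʳ-< h {l} {l'} l<l' =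
    subst₂ _<_ (≡.sym (toℕ-combine h l)) (≡.sym (toℕ-combine h l')) (+-monoʳ-< _ l<l')

  blockParent-< : ∀ h l → ⟨ h , l ⟩ ≢ root → toℕ (blockParent h l) < toℕ ⟨ h , l ⟩
  blockParent-< zero    hubᵤ     ≢root = ⊥-elim (≢root refl)
  blockParent-< (suc h) hubᵤ     _     = s≤s z≤n
  blockParent-< h       hubᵥ     _     = ⟨⟩-monoʳ-< h (s≤s z≤n)
  blockParent-< h       (leaf ℓ) _     with Block.side h ℓ | Block.side-hub h ℓ
  ... | _ | inj₁ refl = ⟨⟩-monoʳ-< h (s≤s z≤n)
  ... | _ | inj₂ refl = ⟨⟩-monoʳ-< h (s≤s (s≤s z≤n))

  star-edge⇒parent : ∀ h {l l'} → DoubleStarAdj (uLeaves h) l l' →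
                     blockParent h l ≡ ⟨ h , l' ⟩ ⊎ blockParent h l' ≡ ⟨ h , l ⟩
  star-edge⇒parent h {hubᵤ}   {hubᵥ}   _ = inj₂ refl
  star-edge⇒parent h {hubᵥ}   {hubᵤ}   _ = inj₁ refl
  star-edge⇒parent h {hubᵤ}   {leaf ℓ} a = inj₂ (cong ⟨ h ,_⟩ (Block.leaf-nbr-unique h ℓ hubᵤ a))
  star-edge⇒parent h {hubᵥ}   {leaf ℓ} a = inj₂ (cong ⟨ h ,_⟩ (Block.leaf-nbr-unique h ℓ hubᵥ a))
  star-edge⇒parent h {leaf ℓ} {hubᵤ}   a = inj₁ (cong ⟨ h ,_⟩ (Block.leaf-nbr-unique h ℓ hubᵤ a))
  star-edge⇒parent h {leaf ℓ} {hubᵥ}   a = inj₁ (cong ⟨ h ,_⟩ (Block.leaf-nbr-unique h ℓ hubᵥ a))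

  edge⇒parent : ∀ {u w} → Adjacent u w → parent u ≡ w ⊎ parent w ≡ u
  edge⇒parent {u} = ⟨⟩-elim (λ u → ∀ {w} → Adjacent u w → parent u ≡ w ⊎ parent w ≡ u) by-block u
    where
    by-block : ∀ h l {w} → Adjacent ⟨ h , l ⟩ w → parent ⟨ h , l ⟩ ≡ w ⊎ parent w ≡ ⟨ h , l ⟩
    by-block h l {w} adj with l' , refl , _ , a ← adjacent⁻ {h} {l} {w} adj
      rewrite parent-⟨⟩ h l | parent-⟨⟩ h l' = star-edge⇒parent h a

  parentTree : ParentTree H
  parentTree = record
    { root        = root
    ; parent      = parent
    ; parent-root = parent-⟨⟩ zero hubᵤ
    ; parent-<    = ⟨⟩-elim (λ v → v ≢ root → toℕ (parent v) < toℕ v)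
                      (λ h l ≢root → subst (λ p → toℕ p < toℕ ⟨ h , l ⟩) (≡.sym (parent-⟨⟩ h l)) (blockParent-< h l ≢root))
    ; edge⇒parent = edge⇒parent
    }

  tw≤1 : TwAtMost H 1
  tw≤1 = parentTree⇒tw≤1 parentTree

  ¬tw≤0 : ¬ TwAtMost H 0
  ¬tw≤0 = edge⇒¬tw≤0 {H} {⟨ h , hubᵤ ⟩} {⟨ h , hubᵥ ⟩} (adjacent⁺ {h} {hubᵤ} {hubᵥ} (pairSlot-used zero zero) tt)
    where h = pairSlot zero zero

-- The classes, the local cover and the lower bound

data 𝒢 : GraphClass where
  K₂∈𝒢 : 𝒢 K2
  S∈𝒢  : ∀ N c → 𝒢 (Construction.S N c)

data IsStar (N : ℕ) (c : Fin N) : ∀ {G} → 𝒢 G → Set where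
  S-is-star : IsStar N c (S∈𝒢 N c)

IsStar-unique : ∀ {N a a' G} {G∈𝒢 : 𝒢 G} → IsStar N a G∈𝒢 → IsStar N a' G∈𝒢 → a ≡ a'
IsStar-unique S-is-star S-is-star = refl

data ℋ : GraphClass where
  H∈ℋ : ∀ N₀ → ℋ (Construction.H (suc N₀))

module StarCover (N : ℕ) where
  open Construction N

  starFamily : Family H
  starFamily = record { k = N ; F = S ; φ = embed ; hom = λ c x y xy → xy }

  starFamily-edgeSurj : EdgeSurj starFamily
  starFamily-edgeSurj v w adj@(same-slot , used , _) =
    a , ⟪ b , loc v ⟫ , ⟪ b , loc w ⟫ , subst₂ Adjacent (≡.sym (hits v refl)) (≡.sym (hits w same-slot)) adj
      , hits v refl , hits w same-slot
    where
    a = proj₁ (remQuot {N} N (slot v))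
    b = proj₂ (remQuot {N} N (slot v))
    hits : ∀ u → slot v ≡ slot u → embed a ⟪ b , loc u ⟫ ≡ u
    hits u same = begin
      embed a ⟪ b , loc u ⟫          ≡⟨ embed-⟪⟫ a b (loc u) ⟩
      ⟨ pairSlot a b , loc u ⟩       ≡⟨ cong ⟨_, loc u ⟩ (≡.trans (pairSlot-remQuot (slot v) used) same) ⟩
      ⟨ slot u , loc u ⟩             ≡⟨ combine-remQuot {N * N} (blockSize N) u ⟩
      u                              ∎
      where open ≡.≡-Reasoning

  -- Only S a and S a' meet the block {a, a'}.
  preimages-embed≤δ : ∀ v a → preimages (embed a) v ≤ δ (proj₁ (slotPair v)) a + δ (proj₂ (slotPair v)) a
  preimages-embed≤δ v a with any? (λ z → embed a z ≟ v)
  ... | no  missed = ≤-trans (≤-reflexive (preimages≡0 (λ z hit → missed (z , hit)))) z≤n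
  ... | yes (z , hit) with embed-hits a z hit
  ... | inj₁ refl = ≤-trans (preimages-injective≤1 (embed-injective a) v) (≤-trans (≤-reflexive (≡.sym (δ-diag a))) (m≤m+n _ _))
  ... | inj₂ refl = ≤-trans (preimages-injective≤1 (embed-injective a) v) (≤-trans (≤-reflexive (≡.sym (δ-diag a))) (m≤n+m _ (δ (proj₁ (slotPair v)) a)))

  starFamily-fibre≤2 : ∀ v → fibre starFamily v ≤ 2
  starFamily-fibre≤2 v = begin
    sum (map (λ a → preimages (embed a) v) (allFin N))   ≡⟨ cong sum (map-tabulate {n = N} id (λ a → preimages (embed a) v)) ⟩
    sum (tabulate (λ a → preimages (embed a) v))         ≤⟨ sum-tabulate-mono (preimages-embed≤δ v) ⟩
    sum (tabulate (λ a → δ x a + δ y a))                 ≡⟨ sum-tabulate-+ (δ x) (δ y) ⟩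
    sum (tabulate (δ x)) + sum (tabulate (δ y))          ≡⟨ ≡.cong₂ _+_ (sum-tabulate-δ x) (sum-tabulate-δ y) ⟩
    2                                                     ∎
    where
    open ≤-Reasoning
    x = proj₁ (slotPair v)
    y = proj₂ (slotPair v)

  twoLocalCover : LocalCover 𝒢 H 2
  twoLocalCover = starFamily , S∈𝒢 N , starFamily-edgeSurj , embed-injective , starFamily-fibre≤2

module Rigidity {N : ℕ} (c : Fin N) (ψ : Fin (starOrder N) → Fin (order N))
                (hom : IsHom (Construction.S N c) (Construction.H N) ψ) (ψ-injective : Injective _≡_ _≡_ ψ) where
  open Construction N

  degree-bound : ∀ {x w d D} → ψ x ≡ w → Degree≥ (S c) x d → Degree≤ H w D → d ≤ D
  degree-bound refl = injective-hom-degree {S c} {H} hom ψ-injective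

  edge-slot : ∀ b {l l'} → DoubleStarAdj (uLeaves (pairSlot c b)) l l' → slot (ψ ⟪ b , l ⟫) ≡ slot (ψ ⟪ b , l' ⟫)
  edge-slot b a = proj₁ (hom _ _ (star-adjacent c b a))

  block↦block : ∀ b l → slot (ψ ⟪ b , l ⟫) ≡ slot (ψ ⟪ b , hubᵤ ⟫)
  block↦block b hubᵤ     = refl
  block↦block b hubᵥ     = edge-slot b {hubᵥ} {hubᵤ} tt
  block↦block b (leaf ℓ) with Block.side (pairSlot c b) ℓ | Block.side-hub (pairSlot c b) ℓ | Block.side-adj (pairSlot c b) ℓ
  ... | _ | inj₁ refl | a = edge-slot b a
  ... | _ | inj₂ refl | a = ≡.trans (edge-slot b a) (block↦block b hubᵥ)

  hubᵤ↦hubᵤ : ∀ b → ∃[ g ] ψ ⟪ b , hubᵤ ⟫ ≡ ⟨ g , hubᵤ ⟩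
  hubᵤ↦hubᵤ b with hubᵤ-or-degree≤ (ψ ⟪ b , hubᵤ ⟫)
  ... | inj₁ hub            = hub
  ... | inj₂ (D , D≤ , deg) = ⊥-elim (<⇒≱ N²<uLeaves (≤-pred (≤-trans (degree-bound refl (star-hubᵤ-degree≥ c b) deg) D≤)))
    where
    N²<uLeaves : N * N < uLeaves (pairSlot c b)
    N²<uLeaves = <-≤-trans (N²<minULeaves (<-≤-trans (s≤s z≤n) (toℕ<n c))) (m≤m+n _ _)

  hubᵥ↦hubᵥ : ∀ b g → ψ ⟪ b , hubᵤ ⟫ ≡ ⟨ g , hubᵤ ⟩ → ψ ⟪ b , hubᵥ ⟫ ≡ ⟨ g , hubᵥ ⟩
  hubᵥ↦hubᵥ b g ↦hub with adjacent⁻ {g} {hubᵤ} {ψ ⟪ b , hubᵥ ⟫}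
    (subst (λ v → Adjacent v (ψ ⟪ b , hubᵥ ⟫)) ↦hub (hom _ _ (star-adjacent c b {hubᵤ} {hubᵥ} tt)))
  ... | hubᵤ   , _     , _ , ()
  ... | hubᵥ   , ↦hubᵥ , _ = ↦hubᵥ
  ... | leaf ℓ , ↦leaf , _ =
    ⊥-elim (<⇒≱ (s≤s (0<vLeaves (pairSlot c b))) (degree-bound ↦leaf (star-hubᵥ-degree≥ c b) (leaf-degree≤ g ℓ)))

  -- The degrees of both hubs pin down the slot.
  hubᵤ-image : ∀ b → ψ ⟪ b , hubᵤ ⟫ ≡ ⟨ pairSlot c b , hubᵤ ⟩
  hubᵤ-image b with hubᵤ↦hubᵤ b
  ... | g , ↦hub = ≡.trans ↦hub (cong ⟨_, hubᵤ ⟩ (≡.sym (leaves-determine-slot u≤ v≤)))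
    where
    u≤ = ≤-pred (degree-bound ↦hub (star-hubᵤ-degree≥ c b) (hubᵤ-degree≤ g))
    v≤ = ≤-pred (degree-bound (hubᵥ↦hubᵥ b g ↦hub) (star-hubᵥ-degree≥ c b) (hubᵥ-degree≤ g))

  hubᵤ-preimage : ∀ x g → ψ x ≡ ⟨ g , hubᵤ ⟩ → ∃[ b ] pairSlot c b ≡ g
  hubᵤ-preimage = ⟪⟫-elim _ λ b l g ↦hub → b , (begin
    pairSlot c b              ≡⟨ slot-⟨⟩ (pairSlot c b) hubᵤ ⟨
    slot ⟨ pairSlot c b , hubᵤ ⟩ ≡⟨ cong slot (hubᵤ-image b) ⟨
    slot (ψ ⟪ b , hubᵤ ⟫)     ≡⟨ block↦block b l ⟨
    slot (ψ ⟪ b , l ⟫)        ≡⟨ cong slot ↦hub ⟩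
    slot ⟨ g , hubᵤ ⟩         ≡⟨ slot-⟨⟩ g hubᵤ ⟩
    g                         ∎)
    where open ≡.≡-Reasoning

module LowerBound (N : ℕ) where
  open Construction N

  large-piece-is-star : ∀ {G} (G∈𝒢 : 𝒢 G) {ψ : Fin (n G) → V} → IsHom G H ψ → Injective _≡_ _≡_ ψ →
                        θ N ≤ n G → ∀ x g → ψ x ≡ ⟨ g , hubᵤ ⟩ → ∃[ c ] IsStar N c G∈𝒢 × ∃[ b ] pairSlot c b ≡ g
  large-piece-is-star K₂∈𝒢      _   _     large = ⊥-elim (<⇒≱ (3≤θ N) large)
  large-piece-is-star (S∈𝒢 M c) hom ψ-inj large x g ↦hub with <-cmp M N
  ... | tri< M<N _ _ = ⊥-elim (<⇒≱ (starOrder<θ M<N) large)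
  ... | tri> _ _ N<M = ⊥-elim (<⇒≱ (order<starOrder N<M) (injective⇒≤ ψ-inj))
  ... | tri≈ _ refl _ = c , S-is-star , Rigidity.hubᵤ-preimage c _ hom ψ-inj x g ↦hub

  star-hits-hub : ∀ {G} {G∈𝒢 : 𝒢 G} {a} → IsStar N a G∈𝒢 → ∀ {ψ : Fin (n G) → V} → IsHom G H ψ → Injective _≡_ _≡_ ψ →
                  ∀ b → ∃[ x ] ψ x ≡ ⟨ pairSlot a b , hubᵤ ⟩
  star-hits-hub {a = a} S-is-star hom ψ-inj b = ⟪ b , hubᵤ ⟫ , Rigidity.hubᵤ-image a _ hom ψ-inj b

  module _ {t} (Ψ : Fin t → Family H) (in𝒢 : ∀ i → InClass 𝒢 (Ψ i))
           (cover : ∀ u v → E H u v → Σ[ i ∈ Fin t ] CoveredBy (Ψ i) u v)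
           (injective : ∀ i → InjectiveOnUnion (Ψ i)) where

    piece-injective : ∀ i j → Injective _≡_ _≡_ (φ (Ψ i) j)
    piece-injective i = injectiveOnUnion⇒injective {Φ = Ψ i} (injective i)

    StarIn : Fin N → Set
    StarIn a = Σ[ i ∈ Fin t ] Σ[ j ∈ Fin (k (Ψ i)) ] IsStar N a (in𝒢 i j)

    -- The hub of block {a, a} has more neighbours than t families of small pieces can cover.
    star-in-family : t ≤ N → ∀ a → StarIn a
    star-in-family t≤N a
      with i , j , x , ↦hub , large ← large-piece-at Ψ cover injective (hubᵤ-degree≥ (pairSlot-used a a)) (θ N)
                                                 (t*θ<1+uLeaves t≤N (pairSlot a a))
      with c , c-star , b , slot≡ ← large-piece-is-star (in𝒢 i j) (hom (Ψ i) j) (piece-injective i j) large x (pairSlot a a) ↦hub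
      with pairSlot-member c b a a slot≡
    ... | inj₁ refl = i , j , c-star
    ... | inj₂ refl = i , j , c-star

    -- S a and S a' share the hub of block {a, a'}, so they lie in different families.
    one-star-per-family : ∀ {a a'} (s : StarIn a) (s' : StarIn a') → proj₁ s ≡ proj₁ s' → a ≡ a'
    one-star-per-family {a} {a'} (i , j , a-star) (.i , j' , a'-star) refl
      with x  , ↦hub  ← star-hits-hub a-star  (hom (Ψ i) j)  (piece-injective i j)  a'
      with x' , ↦hub' ← star-hits-hub a'-star (hom (Ψ i) j') (piece-injective i j') a
      with refl ← injective i (≡.trans ↦hub (≡.trans (cong ⟨_, hubᵤ ⟩ (pairSlot-comm a a')) (≡.sym ↦hub')))
      = IsStar-unique a-star a'-star

  globalCover⇒N≤t : ∀ t → GlobalCover 𝒢 H t → N ≤ t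
  globalCover⇒N≤t t (Ψ , in𝒢 , cover , injective) with N ≤? t
  ... | yes N≤t = N≤t
  ... | no  N≰t = ⊥-elim (<⇒≱ (≰⇒> N≰t) (injective⇒≤ {f = proj₁ ∘ star} λ {a} {a'} →
                    one-star-per-family Ψ in𝒢 cover injective (star a) (star a')))
    where
    star : ∀ a → StarIn Ψ in𝒢 cover injective a
    star = star-in-family Ψ in𝒢 cover injective (ℕ.<⇒≤ (≰⇒> N≰t))

fs≤f0+f1+f2 : (f : ℕ → ℕ) → ∀ {s} → s ≤ 2 → f s ≤ f 0 + f 1 + f 2
fs≤f0+f1+f2 f z≤n             = ≤-trans (m≤m+n (f 0) (f 1)) (m≤m+n _ (f 2))
fs≤f0+f1+f2 f (s≤s z≤n)       = ≤-trans (m≤n+m (f 1) (f 0)) (m≤m+n _ (f 2))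
fs≤f0+f1+f2 f (s≤s (s≤s z≤n)) = m≤n+m (f 2) _

ℋ-tw≡1 : SupTwEqOne ℋ
ℋ-tw≡1 = (λ { _ (H∈ℋ N₀) → Treewidth.tw≤1 N₀ }) , Construction.H 1 , H∈ℋ 0 , Treewidth.¬tw≤0 0

ℋ-unbounded : ¬ Bounded 𝒢 ℋ
ℋ-unbounded (f , bounded) =
  ¬¬-minimum (LocalCover 𝒢 H) local λ (s , cₗ≡s) →
  ¬¬-minimum (GlobalCover 𝒢 H) (proj₂ (local⇒global {𝒢} local)) λ (t , cᵤ≡t) →
  <⇒≱ (s≤s (fs≤f0+f1+f2 f (proj₂ cₗ≡s 2 local)))
      (≤-trans (LowerBound.globalCover⇒N≤t N t (proj₁ cᵤ≡t)) (proj₂ (bounded H (H∈ℋ _) s t cₗ≡s cᵤ≡t)))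
  where
  N = suc (f 0 + f 1 + f 2)
  H = Construction.H N
  local = StarCover.twoLocalCover N

theorem5 : Σ[ ℋ ∈ GraphClass ] Σ[ 𝒢 ∈ GraphClass ] (SupTwEqOne ℋ × 𝒢 K2 × ¬ Bounded 𝒢 ℋ)
theorem5 = ℋ , 𝒢 , ℋ-tw≡1 , K₂∈𝒢 , ℋ-unbounded
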